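{- Let $d\ge2$ and $n\ge0$. The set $S^{d-1}_n\big((21,12),231\big)$ of $d$-permutations of size $n$ avoiding the patterns $(21,12)$ and $231$ equals the set of $d$-permutations of size $n$ that are admissible with respect to ${\bf C}_F$.
   Context: A $d$-permutation of size $n$ is a tuple $\boldsymbol{\pi}=(\pi_1,\ldots,\pi_{d-1})$ of permutations of $[n]$; put $\pi_0=\mathrm{id}$. Its points are $(i,\pi_1(i),\ldots,\pi_{d-1}(i))$, $i\in[n]$; $\pi_l(p)$ is the $l$-th coordinate of $p$. For distinct points $p,q$, ${\bf dir}(p,q)=(\mathrm{sign}(\pi_0(q)-\pi_0(p)),\ldots,\mathrm{sign}(\pi_{d-1}(q)-\pi_{d-1}(p)))$. $\mathbb{F}^d$ is the set of directions in $\{+1,-1\}^d$ with last entry $-1$. Max-tree $\gamma^d(\boldsymbol\pi)$: a rooted tree in which every node is a leaf or internal with $2^{d-1}$ children labelled by the directions of $\mathbb{F}^d$; empty $\boldsymbol\pi$ gives a leaf; otherwise the root corresponds to the point $p_{\max}$ with $\pi_{d-1}(p_{\max})=n$ and the child labelled ${\bf f}$ is the max-tree of the sub-$d$-permutation of points $p'$ with ${\bf dir}(p_{\max},p')={\bf f}$ (relabelled order-preservingly). Internal nodes correspond to points; $\mathcal{T}_{\bf f}(r)$ is the subtree at the child of $r$ labelled ${\bf f}$. $F=\{{\bf dir}^0,\ldots,{\bf dir}^{d-1}\}$ with ${\bf dir}^i=(+1$ repeated $i$ times, $-1$ repeated $d-i$ times$)$. ${\bf C}_F=(C,\ldots,C)$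 ($d$ copies) where $C$ orders $F$ by ${\bf dir}^i$ before ${\bf dir}^j$ iff $i<j$. $\boldsymbol\pi$ is admissible with respect to ${\bf C}_F$ if (i) for every internal node $r$ of $\gamma^d(\boldsymbol\pi)$, every $l\in\{0,\ldots,d-1\}$ and all $i<j$, every point of a node of $\mathcal{T}_{{\bf dir}^i}(r)$ has smaller $l$-th coordinate than every point of a node of $\mathcal{T}_{{\bf dir}^j}(r)$; and (ii) there are no internal nodes $r_1,r_2$ with $r_1\in\mathcal{T}_{\bf f}(r_2)$ for some ${\bf f}\in\mathbb{F}^d\setminus F$. Containment is via direct projections $(\pi_{i_2}\pi_{i_1}^{ -1},\ldots)$, $i_1<i_2<\cdots$: $\boldsymbol\pi$ contains $(21,12)$ iff there are points $p,q$ and $0\le i<j<k\le d-1$ with $\pi_i(p)<\pi_i(q)$, $\pi_j(p)>\pi_j(q)$, $\pi_k(p)<\pi_k(q)$; it contains $231$ iff there are $0\le i<j\le d-1$ and points $a,b,c$ with $\pi_i(a)<\pi_i(b)<\pi_i(c)$ and $\pi_j(c)<\pi_j(a)<\pi_j(b)$. -}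

module Defs where

open import Data.Nat using (ℕ; zero; suc)
open import Data.Bool using (Bool; true; false; _∧_; not; if_then_else_)
open import Data.Fin using (Fin; zero; suc; toℕ; fromℕ; inject₁; _<_; _≟_)
open import Data.Fin.Permutation using (Permutation′; _⟨$⟩ʳ_)
open import Data.List using (List; []; _∷_; filterᵇ; allFin)
open import Data.Product using (Σ; ∃; _×_; _,_)
open import Relation.Nullary using (¬_; does)
open import Relation.Binary.PropositionalEquality using (_≡_)
open import Function.Bundles using (_⇔_)
import Data.Nat as ℕ

-- d-permutations.  We write d = suc e (so e = d - 1).
-- A d-permutation of size n is a tuple (π₁,…,π_{d-1}) of permutations of
-- [n]; points are indexed by i : Fin n (the 0-th coordinate).

DPerm : ℕ → ℕ → Set
DPerm e n = Fin e → Permutation′ n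

coord : ∀ {e n} → DPerm e n → Fin (suc e) → Fin n → Fin n
coord π zero    i = i
coord π (suc l) i = π l ⟨$⟩ʳ i

lastC : ∀ {e n} → DPerm e n → Fin n → Fin n
lastC {e} π = coord π (fromℕ e)

Contains2112 : ∀ {e n} → DPerm e n → Set
Contains2112 {e} {n} π =
  Σ (Fin n) λ p → Σ (Fin n) λ q →
  Σ (Fin (suc e)) λ i → Σ (Fin (suc e)) λ j → Σ (Fin (suc e)) λ k →
    (i < j) × (j < k) ×
    (coord π i p < coord π i q) × (coord π j q < coord π j p) ×
    (coord π k p < coord π k q)

Contains231 : ∀ {e n} → DPerm e n → Set
Contains231 {e} {n} π =
  Σ (Fin (suc e)) λ i → Σ (Fin (suc e)) λ j → (i < j) ×
  Σ (Fin n) λ a → Σ (Fin n) λ b → Σ (Fin n) λ c →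
    (coord π i a < coord π i b) × (coord π i b < coord π i c) ×
    (coord π j c < coord π j a) × (coord π j a < coord π j b)

Avoids : ∀ {e n} → DPerm e n → Set
Avoids π = ¬ Contains2112 π × ¬ Contains231 π

-- Directions.  A direction of 𝔽^d (last entry -1) is determined by its
-- first d-1 = e entries; we encode it as Fin e → Bool (true = +1).

Label : ℕ → Set
Label e = Fin e → Bool

_<ᵇ_ : ∀ {n} → Fin n → Fin n → Bool
a <ᵇ b = toℕ a ℕ.<ᵇ toℕ b

dirLabel : ∀ {e n} → DPerm e n → Fin n → Fin n → Label e
dirLabel π p q k = coord π (inject₁ k) p <ᵇ coord π (inject₁ k) q

sameLabel : ∀ {e} → Label e → Label e → Bool
sameLabel {zero}  f g = true
sameLabel {suc e} f g =
  (if f zero then g zero else not (g zero)) ∧ sameLabel (λ k → f (suc k)) (λ k → g (suc k))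

-- dir^i (i ∈ {0,…,d-1}): +1 repeated i times then -1; first e entries
dirF : ∀ {e} → Fin (suc e) → Label e
dirF i k = toℕ k ℕ.<ᵇ toℕ i

InF : ∀ {e} → Label e → Set
InF {e} f = Σ (Fin (suc e)) λ i → ∀ k → f k ≡ dirF i k

-- Internal nodes store the point (as an index of the
-- original d-permutation; relabelling is order preserving, so all
-- coordinate comparisons are unaffected) and the children, labelled by
-- 𝔽^d.

data Tree (e n : ℕ) : Set where
  leaf : Tree e n
  node : Fin n → (Label e → Tree e n) → Tree e n

maxPt : ∀ {e n} → DPerm e n → Fin n → List (Fin n) → Fin n
maxPt π x []       = x
maxPt π x (y ∷ ys) =
  let m = maxPt π y ys in
  if lastC π x <ᵇ lastC π m then m else x

-- is q in the f-child of pmax?  (q ≠ pmax and dir(pmax,q) = f; the last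
-- entry -1 is automatic since pmax has maximal last coordinate)
inChild : ∀ {e n} → DPerm e n → Fin n → Label e → Fin n → Bool
inChild π m f q = not (does (m ≟ q)) ∧ sameLabel (dirLabel π m q) f

-- max-tree of the sub-d-permutation on the given set of points; the
-- fuel argument bounds the depth (fuel n suffices for n points)
maxTree′ : ∀ {e n} → DPerm e n → ℕ → List (Fin n) → Tree e n
maxTree′ π zero    _        = leaf
maxTree′ π (suc k) []       = leaf
maxTree′ π (suc k) (x ∷ xs) =
  let m = maxPt π x xs in
  node m (λ f → maxTree′ π k (filterᵇ (inChild π m f) (x ∷ xs)))

maxTree : ∀ {e n} → DPerm e n → Tree e n
maxTree {n = n} π = maxTree′ π n (allFin n)

data _∈T_ {e n} (p : Fin n) : Tree e n → Set where
  here  : ∀ {c} → p ∈T node p c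
  there : ∀ {q c} (f : Label e) → p ∈T c f → p ∈T node q c

data _≼_ {e n} : Tree e n → Tree e n → Set where
  self  : ∀ {t} → t ≼ t
  child : ∀ {s q c} (f : Label e) → s ≼ c f → s ≼ node q c

Admissible : ∀ {e n} → DPerm e n → Set
Admissible {e} {n} π =
  -- (i)
  (∀ (r : Fin n) (c : Label e → Tree e n) → node r c ≼ maxTree π →
     ∀ (l i j : Fin (suc e)) → i < j →
     ∀ (a b : Fin n) → a ∈T c (dirF i) → b ∈T c (dirF j) →
     coord π l a < coord π l b)
  ×
  -- (ii)
  (∀ (r₂ : Fin n) (c : Label e → Tree e n) → node r₂ c ≼ maxTree π →
     ∀ (f : Label e) → ¬ InF f →
     ∀ (r₁ : Fin n) (c₁ : Label e → Tree e n) → ¬ (node r₁ c₁ ≼ c f))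

-- Avoiding (21,12) means that the relative order of two points changes at
-- most once along the coordinates 0,…,d-1.  So if a lies below r in the
-- max-tree (smaller last coordinate), dir(r,a) is of the form dir^t: a lies
-- above r exactly in the coordinates l < t, which is condition (ii).  If
-- moreover a and b lie in directions dir^I and dir^J from r with I < J, then
-- a <_I r <_I b, and a reversal of a and b at any coordinate l would give a
-- 231 on the coordinates l and I; this is condition (i).
-- Conversely, assume (i) and (ii) and take an occurrence of either pattern in
-- the points of a subtree with root m.  By (ii) the t-th child of m consists
-- of points lying above m exactly in the coordinates l < t, and by (i) the
-- children are ordered in every coordinate; a case analysis then shows that
-- the occurrence neither uses m nor meets two children.  So it lies inside one
-- child, and we conclude by induction on the max-tree.

module Submission where

open import Defs
open import Data.Nat using (ℕ; suc; _≤_)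
open import Function.Bundles using (_⇔_)

open import Data.Bool using (true; false; T)
open import Data.Bool.Properties as Bool using (T?)
open import Data.Empty using (⊥-elim)
open import Data.Fin as Fin using (Fin; zero; suc; toℕ; fromℕ; inject₁; _<_; _≟_)
open import Data.Fin.Properties
  using ( <-irrefl; <-asym; <-trans; <-cmp; _<?_; ≤∧≢⇒<; ≤fromℕ
        ; toℕ-fromℕ; toℕ-inject₁; inject₁ℕ<; any?; all?)
open import Data.List using (List; []; _∷_; length; allFin; filterᵇ)
open import Data.List.Membership.Propositional using (_∈_)
open import Data.List.Membership.Propositional.Properties using (∈-filter⁺; ∈-filter⁻; ∈-allFin)
open import Data.List.Properties using (filter-notAll; length-tabulate)
import Data.List.Relation.Unary.Any as Any
import Data.Nat as ℕ
import Data.Nat.Properties as ℕₚ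
open import Data.Product using (Σ; ∃; _×_; _,_; proj₁; proj₂)
open import Data.Sum using (_⊎_; inj₁; inj₂)
open import Function using (_∘_; id)
open import Function.Bundles using (mk⇔; Equivalence; Injection)
open import Function.Properties.Inverse using (↔⇒↣)
open import Relation.Binary.Definitions using (Tri; tri<; tri≈; tri>)
open import Relation.Binary.PropositionalEquality
  using (_≡_; _≢_; _≗_; refl; sym; trans; subst; subst₂)
open import Relation.Nullary using (¬_; yes; no; Dec)
open import Relation.Nullary.Reflects using (ofʸ; ofⁿ)

open Equivalence using (to; from)

<ᵇ-≡⇒⇔ : ∀ {a b c d : ℕ} → (a ℕ.<ᵇ b) ≡ (c ℕ.<ᵇ d) → (a ℕ.< b ⇔ c ℕ.< d)
<ᵇ-≡⇒⇔ {a} {b} {c} {d} eq = mk⇔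
  (λ a<b → ℕₚ.<ᵇ⇒< c d (subst T eq (ℕₚ.<⇒<ᵇ a<b)))
  (λ c<d → ℕₚ.<ᵇ⇒< a b (subst T (sym eq) (ℕₚ.<⇒<ᵇ c<d)))

last-or-inject₁ : ∀ {e} (l : Fin (suc e)) → l ≡ fromℕ e ⊎ ∃ λ k → l ≡ inject₁ k
last-or-inject₁ {ℕ.zero}  zero    = inj₁ refl
last-or-inject₁ {suc e}   zero    = inj₂ (zero , refl)
last-or-inject₁ {suc e}   (suc l) with last-or-inject₁ l
... | inj₁ refl       = inj₁ refl
... | inj₂ (k , refl) = inj₂ (suc k , refl)

inject₁-mono-< : ∀ {e} {k₁ k₂ : Fin e} → k₁ < k₂ → inject₁ k₁ < inject₁ k₂
inject₁-mono-< {k₁ = k₁} {k₂} = subst₂ ℕ._<_ (sym (toℕ-inject₁ k₁)) (sym (toℕ-inject₁ k₂))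

inject₁<fromℕ : ∀ {e} (k : Fin e) → inject₁ k < fromℕ e
inject₁<fromℕ {e} k = subst (toℕ (inject₁ k) ℕ.<_) (sym (toℕ-fromℕ e)) (inject₁ℕ< k)

sameLabel⇒≗ : ∀ {e} {f g : Label e} → T (sameLabel f g) → f ≗ g
sameLabel⇒≗ {suc e} {f} {g} s zero with f zero | g zero
... | true  | true  = refl
... | false | false = refl
sameLabel⇒≗ {suc e} {f} {g} s (suc k) with f zero | g zero
... | true  | true  = sameLabel⇒≗ s k
... | false | false = sameLabel⇒≗ s k

≗⇒sameLabel : ∀ {e} {f g : Label e} → f ≗ g → T (sameLabel f g)
≗⇒sameLabel {ℕ.zero} _ = _
≗⇒sameLabel {suc e} {f} {g} f≗g with f zero | g zero | f≗g zero
... | true  | true  | refl = ≗⇒sameLabel (f≗g ∘ suc)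
... | false | false | refl = ≗⇒sameLabel (f≗g ∘ suc)

InF-resp-≗ : ∀ {e} {f g : Label e} → f ≗ g → InF f → InF g
InF-resp-≗ f≗g (i , f≗dirF) = i , λ k → trans (sym (f≗g k)) (f≗dirF k)

InF? : ∀ {e} (f : Label e) → Dec (InF f)
InF? f = any? λ i → all? λ k → f k Bool.≟ dirF i k

rising⇒InF : ∀ {e} (f : Label e) → (∀ {k₁ k₂} → k₁ < k₂ → T (f k₂) → T (f k₁)) → InF f
rising⇒InF {ℕ.zero} f _ = zero , λ ()
rising⇒InF {suc e} f rising with f zero in f₀
... | false = zero , all-false
  where
  all-false : ∀ k → f k ≡ false
  all-false zero = f₀
  all-false (suc k) with f (suc k) in fₖ
  ... | false = refl
  ... | true  = ⊥-elim (subst T f₀ (rising ℕ.z<s (subst T (sym fₖ) _)))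
... | true with rising⇒InF (f ∘ suc) (rising ∘ ℕ.s<s)
...   | i , f≗dirF = suc i , λ { zero → f₀ ; (suc k) → f≗dirF k }

module _ {e n : ℕ} (π : DPerm e n) where

  infix 4 _<[_]_

  _<[_]_ : Fin n → Fin (suc e) → Fin n → Set
  p <[ l ] q = coord π l p < coord π l q

  coord-injective : ∀ l {p q} → coord π l p ≡ coord π l q → p ≡ q
  coord-injective zero    eq = eq
  coord-injective (suc l) = Injection.injective (↔⇒↣ (π l))

  ≮[]⇒> : ∀ l {p q} → p ≢ q → ¬ p <[ l ] q → q <[ l ] p
  ≮[]⇒> l {p} {q} p≢q p≮q with <-cmp (coord π l p) (coord π l q)
  ... | tri< p<q _ _ = ⊥-elim (p≮q p<q)
  ... | tri≈ _ p≡q _ = ⊥-elim (p≢q (coord-injective l p≡q))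
  ... | tri> _ _ q<p = q<p

  <[]⇒≢ : ∀ l {p q} → p <[ l ] q → p ≢ q
  <[]⇒≢ l p<q refl = <-irrefl refl p<q

  record Below (r : Fin n) (f : Label e) (a : Fin n) : Set where
    field
      distinct  : r ≢ a
      lower     : lastC π a < lastC π r
      direction : dirLabel π r a ≗ f

  module _ {m p : Fin n} {t : Fin (suc e)} (p▷m : Below m (dirF t) p) where
    open Below p▷m

    above⇔< : ∀ l → m <[ l ] p ⇔ l < t
    above⇔< l with last-or-inject₁ l
    ... | inj₁ refl = mk⇔ (λ m<p → ⊥-elim (<-asym m<p lower))
                          (λ l<t → ⊥-elim (ℕₚ.<⇒≱ l<t (≤fromℕ t)))
    ... | inj₂ (k , refl) =
      subst (λ x → m <[ inject₁ k ] p ⇔ x ℕ.< toℕ t) (sym (toℕ-inject₁ k)) (<ᵇ-≡⇒⇔ (direction k))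

    above : ∀ l → l < t → m <[ l ] p
    above l = from (above⇔< l)

    above⇒< : ∀ l → m <[ l ] p → l < t
    above⇒< l = to (above⇔< l)

    below : ∀ l → t Fin.≤ l → p <[ l ] m
    below l t≤l = ≮[]⇒> l distinct (λ m<p → ℕₚ.<⇒≱ (above⇒< l m<p) t≤l)

    below⇒≥ : ∀ l → p <[ l ] m → t Fin.≤ l
    below⇒≥ l p<m = ℕₚ.≮⇒≥ (λ l<t → <-asym p<m (above l l<t))

    above-before-below : ∀ k j → m <[ k ] p → p <[ j ] m → k < j
    above-before-below k j m<p p<m = ℕₚ.<-≤-trans (above⇒< k m<p) (below⇒≥ j p<m)

  _<[_]?_ : ∀ p l q → Dec (p <[ l ] q)
  p <[ l ]? q = coord π l p <? coord π l q

  no2112⇒direction-in-F : ¬ Contains2112 π → ∀ {r f a} → Below r f a → InF f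
  no2112⇒direction-in-F no2112 {r} {f} {a} a▷r = InF-resp-≗ direction (rising⇒InF _ rising)
    where
    open Below a▷r
    rising : ∀ {k₁ k₂} → k₁ < k₂ → T (dirLabel π r a k₂) → T (dirLabel π r a k₁)
    rising {k₁} {k₂} k₁<k₂ r<a with r <[ inject₁ k₁ ]? a
    ... | yes r<a₁ = ℕₚ.<⇒<ᵇ r<a₁
    ... | no  r≮a₁ = ⊥-elim (no2112 (a , r , inject₁ k₁ , inject₁ k₂ , fromℕ e ,
            inject₁-mono-< k₁<k₂ , inject₁<fromℕ k₂ ,
            ≮[]⇒> (inject₁ k₁) distinct r≮a₁ , ℕₚ.<ᵇ⇒< _ _ r<a , lower))

  -- If b <[ l ] a, then r b a (when l < I) or a r b (when I < l) is a 231
  -- at the coordinates l and I.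
  no231⇒blocks-ordered : ¬ Contains231 π → ∀ {r a b I J} →
    Below r (dirF I) a → Below r (dirF J) b → I < J → ∀ l → a <[ l ] b
  no231⇒blocks-ordered no231 {r} {a} {b} {I} {J} a▷r b▷r I<J l with a <[ l ]? b
  ... | yes a<b = a<b
  ... | no  a≮b = ⊥-elim (no231 (occurrence (<-cmp l I)))
    where
    a<r : a <[ I ] r
    a<r = below a▷r I ℕₚ.≤-refl
    r<b : r <[ I ] b
    r<b = above b▷r I I<J
    b<a : b <[ l ] a
    b<a = ≮[]⇒> l (<[]⇒≢ I (<-trans a<r r<b)) a≮b
    occurrence : Tri (l < I) (l ≡ I) (I < l) → Contains231 π
    occurrence (tri< l<I _ _) =
      l , I , l<I , r , b , a , above b▷r l (<-trans l<I I<J) , b<a , a<r , r<b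
    occurrence (tri≈ _ refl _) = ⊥-elim (<-asym (<-trans a<r r<b) b<a)
    occurrence (tri> _ _ I<l) =
      I , l , I<l , a , r , b , a<r , r<b , b<a , below a▷r l (ℕₚ.<⇒≤ I<l)

  Child : Fin n → Label e → List (Fin n) → List (Fin n)
  Child m f = filterᵇ (inChild π m f)

  T-inChild : ∀ {m f q} → T (inChild π m f q) ⇔ (m ≢ q × dirLabel π m q ≗ f)
  T-inChild {m} {f} {q} with m ≟ q
  ... | yes m≡q = mk⇔ (λ ()) (λ (m≢q , _) → m≢q m≡q)
  ... | no  m≢q = mk⇔ (λ s → m≢q , sameLabel⇒≗ s) (≗⇒sameLabel ∘ proj₂)

  ∈-Child⁻ : ∀ m f L {q} → q ∈ Child m f L → q ∈ L × m ≢ q × dirLabel π m q ≗ f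
  ∈-Child⁻ m f L q∈ with ∈-filter⁻ (T? ∘ inChild π m f) q∈
  ... | q∈L , s = q∈L , to T-inChild s

  ∈-Child⁺ : ∀ m f {L q} → q ∈ L → m ≢ q → dirLabel π m q ≗ f → q ∈ Child m f L
  ∈-Child⁺ m f q∈L m≢q dir≗f = ∈-filter⁺ (T? ∘ inChild π m f) q∈L (from T-inChild (m≢q , dir≗f))

  |Child|< : ∀ m f {L} → m ∈ L → length (Child m f L) ℕ.< length L
  |Child|< m f {L} m∈L = filter-notAll (T? ∘ inChild π m f) L
    (Any.map (λ { refl s → proj₁ (to T-inChild s) refl }) m∈L)

  maxPt-∈ : ∀ x xs → maxPt π x xs ∈ x ∷ xs
  maxPt-∈ x []       = Any.here refl
  maxPt-∈ x (y ∷ ys) with lastC π x <ᵇ lastC π (maxPt π y ys)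
  ... | true  = Any.there (maxPt-∈ y ys)
  ... | false = Any.here refl

  maxPt-maximal : ∀ {x xs z} → z ∈ x ∷ xs → lastC π z Fin.≤ lastC π (maxPt π x xs)
  maxPt-maximal {x} {[]}     (Any.here refl) = ℕₚ.≤-refl
  maxPt-maximal {x} {y ∷ ys} z∈
    with lastC π x <ᵇ lastC π (maxPt π y ys)
       | ℕₚ.<ᵇ-reflects-< (toℕ (lastC π x)) (toℕ (lastC π (maxPt π y ys)))
       | z∈
  ... | true  | ofʸ x<m | Any.here refl = ℕₚ.<⇒≤ x<m
  ... | true  | _       | Any.there z∈′ = maxPt-maximal z∈′
  ... | false | _       | Any.here refl = ℕₚ.≤-refl
  ... | false | ofⁿ x≮m | Any.there z∈′ = ℕₚ.≤-trans (maxPt-maximal z∈′) (ℕₚ.≮⇒≥ x≮m)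

  Below-maxPt : ∀ {x xs q f} → q ∈ x ∷ xs →
    maxPt π x xs ≢ q → dirLabel π (maxPt π x xs) q ≗ f → Below (maxPt π x xs) f q
  Below-maxPt q∈ m≢q dir≗f = record
    { distinct  = m≢q
    ; lower     = ≤∧≢⇒< (maxPt-maximal q∈) (λ eq → m≢q (sym (coord-injective (fromℕ e) eq)))
    ; direction = dir≗f
    }

  |Child|≤ : ∀ {k} x xs f → length xs ≤ k → length (Child (maxPt π x xs) f (x ∷ xs)) ≤ k
  |Child|≤ x xs f len = ℕₚ.≤-pred (ℕₚ.<-≤-trans (|Child|< _ f (maxPt-∈ x xs)) (ℕ.s≤s len))

  ∈T-maxTree′⇒∈ : ∀ k L {a} → a ∈T maxTree′ π k L → a ∈ L
  ∈T-maxTree′⇒∈ (suc k) (x ∷ xs) here         = maxPt-∈ x xs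
  ∈T-maxTree′⇒∈ (suc k) (x ∷ xs) (there f a∈) =
    let m = maxPt π x xs in proj₁ (∈-Child⁻ m f (x ∷ xs) (∈T-maxTree′⇒∈ k (Child m f (x ∷ xs)) a∈))

  ∈⇒∈T-maxTree′ : ∀ k L {a} → length L ≤ k → a ∈ L → a ∈T maxTree′ π k L
  ∈⇒∈T-maxTree′ (suc k) (x ∷ xs) {a} (ℕ.s≤s len) a∈ with maxPt π x xs ≟ a
  ... | yes refl = here
  ... | no  m≢a  = there f
    (∈⇒∈T-maxTree′ k (Child m f (x ∷ xs)) (|Child|≤ x xs f len) (∈-Child⁺ m f a∈ m≢a (λ _ → refl)))
    where
    m : Fin n
    m = maxPt π x xs
    f : Label e
    f = dirLabel π m a

  subtree-Below : ∀ k L {r c f a} → node r c ≼ maxTree′ π k L → a ∈T c f → Below r f a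
  subtree-Below (suc k) (x ∷ xs) {f = f} self a∈
    with ∈-Child⁻ (maxPt π x xs) f (x ∷ xs) (∈T-maxTree′⇒∈ k (Child (maxPt π x xs) f (x ∷ xs)) a∈)
  ... | a∈L , m≢a , dir≗f = Below-maxPt a∈L m≢a dir≗f
  subtree-Below (suc k) (x ∷ xs) (child f r≼) a∈ =
    subtree-Below k (Child (maxPt π x xs) f (x ∷ xs)) r≼ a∈

  ≼⇒∈T : ∀ {r : Fin n} {c : Label e → Tree e n} {t : Tree e n} → node r c ≼ t → r ∈T t
  ≼⇒∈T self         = here
  ≼⇒∈T (child f r≼) = there f (≼⇒∈T r≼)

  ∈T⇒≼ : ∀ {r : Fin n} {t : Tree e n} → r ∈T t → ∃ λ c → node r c ≼ t
  ∈T⇒≼ here          = _ , self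
  ∈T⇒≼ (there f r∈) = let c , r≼ = ∈T⇒≼ r∈ in c , child f r≼

  ChildrenSeparated : Tree e n → Set
  ChildrenSeparated t =
    ∀ (r : Fin n) (c : Label e → Tree e n) → node r c ≼ t →
    ∀ (l i j : Fin (suc e)) → i < j →
    ∀ (a b : Fin n) → a ∈T c (dirF i) → b ∈T c (dirF j) →
    coord π l a < coord π l b

  NonFChildrenEmpty : Tree e n → Set
  NonFChildrenEmpty t =
    ∀ (r₂ : Fin n) (c : Label e → Tree e n) → node r₂ c ≼ t →
    ∀ (f : Label e) → ¬ InF f →
    ∀ (r₁ : Fin n) (c₁ : Label e → Tree e n) → ¬ (node r₁ c₁ ≼ c f)

  avoids⇒admissible : Avoids π → Admissible π
  avoids⇒admissible (no2112 , no231) = separated , nonF-empty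
    where
    separated : ChildrenSeparated (maxTree π)
    separated r c r≼ l i j i<j a b a∈ b∈ =
      no231⇒blocks-ordered no231 (subtree-Below n _ r≼ a∈) (subtree-Below n _ r≼ b∈) i<j l
    nonF-empty : NonFChildrenEmpty (maxTree π)
    nonF-empty r₂ c r₂≼ f f∉F r₁ c₁ r₁≼ =
      f∉F (no2112⇒direction-in-F no2112 (subtree-Below n _ r₂≼ (≼⇒∈T r₁≼)))

  Occurrence2112 : Fin n → Fin n → Set
  Occurrence2112 p q =
    Σ (Fin (suc e)) λ i → Σ (Fin (suc e)) λ j → Σ (Fin (suc e)) λ k →
      (i < j) × (j < k) × (p <[ i ] q) × (q <[ j ] p) × (p <[ k ] q)

  Occurrence231 : Fin n → Fin n → Fin n → Set
  Occurrence231 a b c =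
    Σ (Fin (suc e)) λ i → Σ (Fin (suc e)) λ j →
      (i < j) × (a <[ i ] b) × (b <[ i ] c) × (c <[ j ] a) × (a <[ j ] b)

  AvoidsOn : List (Fin n) → Set
  AvoidsOn L =
    (∀ {p q} → p ∈ L → q ∈ L → ¬ Occurrence2112 p q) ×
    (∀ {a b c} → a ∈ L → b ∈ L → c ∈ L → ¬ Occurrence231 a b c)

  AvoidsOn-[] : AvoidsOn []
  AvoidsOn-[] = (λ ()) , (λ ())

  AvoidsOn-allFin⇒Avoids : AvoidsOn (allFin n) → Avoids π
  AvoidsOn-allFin⇒Avoids (no2112 , no231) =
    (λ (p , q , occ) → no2112 (∈-allFin p) (∈-allFin q) occ) ,
    (λ (i , j , i<j , a , b , c , occ) →
       no231 (∈-allFin a) (∈-allFin b) (∈-allFin c) (i , j , i<j , occ))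

  record BlockDecomposition (m : Fin n) (L : List (Fin n)) (B : Fin (suc e) → List (Fin n)) : Set
    where
    field
      classify    : ∀ {a} → a ∈ L → a ≡ m ⊎ ∃ λ t → a ∈ B t
      block-Below : ∀ {a t} → a ∈ B t → Below m (dirF t) a
      separated   : ∀ {a b t u} → a ∈ B t → b ∈ B u → t < u → ∀ l → a <[ l ] b

  module _ {m L B} (D : BlockDecomposition m L B) where
    open BlockDecomposition D

    crossing⇒same-block : ∀ {a b t u} i j → a ∈ B t → b ∈ B u → a <[ i ] b → b <[ j ] a → t ≡ u
    crossing⇒same-block {t = t} {u} i j a∈ b∈ a<b b<a with <-cmp t u
    ... | tri< t<u _ _ = ⊥-elim (<-asym b<a (separated a∈ b∈ t<u j))
    ... | tri≈ _ t≡u _ = t≡u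
    ... | tri> _ _ u<t = ⊥-elim (<-asym a<b (separated b∈ a∈ u<t i))

    straddling⇒ordered : ∀ {a b t u} l → a ∈ B t → b ∈ B u →
      a <[ l ] m → m <[ l ] b → ∀ l′ → a <[ l′ ] b
    straddling⇒ordered {t = t} {u} l a∈ b∈ a<m m<b = separated a∈ b∈ (ℕₚ.≤-<-trans
      (below⇒≥ {t = t} (block-Below a∈) l a<m) (above⇒< {t = u} (block-Below b∈) l m<b))

    AvoidsOn-blocks : (∀ t → AvoidsOn (B t)) → AvoidsOn L
    AvoidsOn-blocks blocks-avoid = no2112 , no231
      where
      no2112 : ∀ {p q} → p ∈ L → q ∈ L → ¬ Occurrence2112 p q
      no2112 p∈ q∈ occ@(i , j , k , i<j , j<k , p<q , q<p , p<q′)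
        with classify p∈ | classify q∈
      ... | inj₁ refl      | inj₁ refl      = <-irrefl refl p<q
      ... | inj₁ refl      | inj₂ (u , q∈B) =
        <-asym j<k (above-before-below {t = u} (block-Below q∈B) k j p<q′ q<p)
      ... | inj₂ (t , p∈B) | inj₁ refl      =
        <-asym i<j (above-before-below {t = t} (block-Below p∈B) j i q<p p<q)
      ... | inj₂ (t , p∈B) | inj₂ (u , q∈B) with crossing⇒same-block i j p∈B q∈B p<q q<p
      ...   | refl = proj₁ (blocks-avoid t) p∈B q∈B occ

      no231 : ∀ {a b c} → a ∈ L → b ∈ L → c ∈ L → ¬ Occurrence231 a b c
      no231 a∈ b∈ c∈ occ@(i , j , i<j , a<b , b<c , c<a , a<b′)
        with classify a∈ | classify b∈ | classify c∈
      ... | inj₁ refl      | inj₁ refl      | _              = <-irrefl refl a<b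
      ... | inj₁ refl      | inj₂ _         | inj₁ refl      = <-irrefl refl c<a
      ... | inj₁ refl      | inj₂ (u , b∈B) | inj₂ (v , c∈B) =
        <-asym b<c (straddling⇒ordered j c∈B b∈B c<a a<b′ i)
      ... | inj₂ _         | inj₁ refl      | inj₁ refl      = <-irrefl refl b<c
      ... | inj₂ (t , a∈B) | inj₁ refl      | inj₂ (v , c∈B) =
        <-asym c<a (straddling⇒ordered i a∈B c∈B a<b b<c j)
      ... | inj₂ (t , a∈B) | inj₂ _         | inj₁ refl      =
        <-asym i<j (above-before-below {t = t} (block-Below a∈B) j i c<a (<-trans a<b b<c))
      ... | inj₂ (t , a∈B) | inj₂ (u , b∈B) | inj₂ (v , c∈B)
        with crossing⇒same-block i j a∈B c∈B (<-trans a<b b<c) c<a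
           | crossing⇒same-block i j b∈B c∈B b<c (<-trans c<a a<b′)
      ...   | refl | refl = proj₂ (blocks-avoid t) a∈B b∈B c∈B occ

  maxTree′-decomposition : ∀ {k} x xs → length xs ≤ k →
    ChildrenSeparated (maxTree′ π (suc k) (x ∷ xs)) →
    NonFChildrenEmpty (maxTree′ π (suc k) (x ∷ xs)) →
    BlockDecomposition (maxPt π x xs) (x ∷ xs) (λ t → Child (maxPt π x xs) (dirF t) (x ∷ xs))
  maxTree′-decomposition {k} x xs len separated nonF-empty = record
    { classify    = classify
    ; block-Below = λ {a} {t} a∈ →
        let a∈L , m≢a , dir≗dirF = ∈-Child⁻ m (dirF t) (x ∷ xs) a∈ in Below-maxPt a∈L m≢a dir≗dirF
    ; separated   = λ {a} {b} {t} {u} a∈ b∈ t<u l →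
        separated m _ self l t u t<u a b (in-child (dirF t) a∈) (in-child (dirF u) b∈)
    }
    where
    m : Fin n
    m = maxPt π x xs

    in-child : ∀ f {a} → a ∈ Child m f (x ∷ xs) → a ∈T maxTree′ π k (Child m f (x ∷ xs))
    in-child f = ∈⇒∈T-maxTree′ k (Child m f (x ∷ xs)) (|Child|≤ x xs f len)

    classify : ∀ {a} → a ∈ x ∷ xs → a ≡ m ⊎ ∃ λ t → a ∈ Child m (dirF t) (x ∷ xs)
    classify {a} a∈ with m ≟ a
    ... | yes refl = inj₁ refl
    ... | no  m≢a with InF? (dirLabel π m a)
    ...   | yes (t , dir≗dirF) = inj₂ (t , ∈-Child⁺ m (dirF t) a∈ m≢a dir≗dirF)
    ...   | no  dir∉F =
      let c , a≼ = ∈T⇒≼ (in-child _ (∈-Child⁺ m (dirLabel π m a) a∈ m≢a (λ _ → refl)))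
      in ⊥-elim (nonF-empty m _ self (dirLabel π m a) dir∉F a c a≼)

  AvoidsOn-maxTree′ : ∀ k L → length L ≤ k →
    ChildrenSeparated (maxTree′ π k L) → NonFChildrenEmpty (maxTree′ π k L) → AvoidsOn L
  AvoidsOn-maxTree′ _       []       _            _         _          = AvoidsOn-[]
  AvoidsOn-maxTree′ (suc k) (x ∷ xs) (ℕ.s≤s len) separated nonF-empty =
    AvoidsOn-blocks (maxTree′-decomposition x xs len separated nonF-empty) λ t →
      AvoidsOn-maxTree′ k (Child (maxPt π x xs) (dirF t) (x ∷ xs)) (|Child|≤ x xs (dirF t) len)
        (λ r c r≼ → separated r c (child (dirF t) r≼))
        (λ r c r≼ → nonF-empty r c (child (dirF t) r≼))

  admissible⇒avoids : Admissible π → Avoids π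
  admissible⇒avoids (separated , nonF-empty) = AvoidsOn-allFin⇒Avoids
    (AvoidsOn-maxTree′ n (allFin n) (ℕₚ.≤-reflexive (length-tabulate id)) separated nonF-empty)

-- The argument does not use d ≥ 2.
lemma4 : (e n : ℕ) → 2 ≤ suc e → (π : DPerm e n) → Avoids π ⇔ Admissible π
lemma4 e n _ π = mk⇔ (avoids⇒admissible π) (admissible⇒avoids π)
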